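{- Let $\mathcal G$ be a skeletal locally finite groupoid and let $S$ be a set, regarded as a 1-morphism $S:\mathbf 1\to\mathbf 1$ of $\mathbf{GpdAct}$. Let $R_{\mathcal G}:\mathcal G\to\mathbf 1$ be the right boundary morphism, and let $P:=R_{\mathcal G}\circ S$ be the composite 1-morphism $\mathcal G\to \mathbf 1$, which as a functor sends each object $G$ of $\mathcal G$ to $\mathrm{Hom}_{\mathcal G}(G,G)\times S$, a morphism $g:G\to G$ acting by postcomposition on the first factor and trivially on $S$. Then the 2-morphisms $\sigma:P\Rightarrow P$ in $\mathbf{GpdAct}$ are in bijective correspondence with families, indexed by the objects $G$ of $\mathcal G$, of $\mathbb N$-valued spans of sets from $S$ to $\mathrm{Hom}_{\mathcal G}(G,G)\times S$, i.e. with families of functions $S\times \mathrm{Hom}_{\mathcal G}(G,G)\times S\to\mathbb N$, one for each $G\in\mathrm{Ob}(\mathcal G)$.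
   Context: $\mathbf{GpdAct}$ is the bicategory whose objects are locally finite groupoids; a 1-morphism $F:\mathcal G\to\mathcal H$ is a functor $F:\mathcal H^{\mathrm{op}}\times\mathcal G\to\mathbf{Set}$ (a profunctor), composed by the standard profunctor composition; and a 2-morphism $\sigma:F\Rightarrow F'$ between 1-morphisms $F,F':\mathcal G\to\mathcal H$ is a natural transformation $\sigma:F\times F'\Rightarrow\mathbb N$, where $F\times F'$ is the pointwise product functor and $\mathbb N$ is the constant functor sending every morphism to the identity of the set of natural numbers; concretely, $\sigma$ is a family of functions $\sigma_c:F(c)\times F'(c)\to\mathbb N$ with $\sigma_{c'}(F(f)x,F'(f)y)=\sigma_c(x,y)$ for all morphisms $f:c\to c'$ (such a function $X\times Y\to\mathbb N$ is called an $\mathbb N$-valued span from $X$ to $Y$). $\mathbf 1$ denotes the trivial groupoid (one object, one morphism), so a 1-morphism $\mathbf 1\to\mathbf 1$ is just a set. A groupoid is skeletal if isomorphic objects are equal (so all morphisms are endomorphisms). The right boundary morphism $R_{\mathcal G}:\mathcal G\to\mathbf 1$ is the functor $\mathbf 1^{\mathrm{op}}\times\mathcal G\to\mathbf{Set}$ sending $(\bullet,G)$ to $\mathrm{Hom}_{\mathcal G}(G,G)$, with $g:G\to G$ acting by postcomposition. -}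

module Defs where

open import Data.Nat using (ℕ)
open import Data.Fin using (Fin)
open import Data.Product using (Σ; _×_; _,_)
open import Function.Bundles using (_↔_)
open import Relation.Binary.PropositionalEquality using (_≡_; subst)
open import Relation.Binary.Bundles using (Setoid)
open import Relation.Binary.Structures using (IsEquivalence)
import Relation.Binary.PropositionalEquality as Eq

record Groupoid : Set₁ where
  field
    Obj : Set
    Hom : Obj → Obj → Set
    id  : ∀ {A} → Hom A A
    _∘_ : ∀ {A B C} → Hom B C → Hom A B → Hom A C
    inv : ∀ {A B} → Hom A B → Hom B A
    idˡ : ∀ {A B} (f : Hom A B) → id ∘ f ≡ f
    idʳ : ∀ {A B} (f : Hom A B) → f ∘ id ≡ f
    assoc : ∀ {A B C D} (h : Hom C D) (g : Hom B C) (f : Hom A B) →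
            (h ∘ g) ∘ f ≡ h ∘ (g ∘ f)
    invˡ : ∀ {A B} (f : Hom A B) → inv f ∘ f ≡ id
    invʳ : ∀ {A B} (f : Hom A B) → f ∘ inv f ≡ id

IsLocallyFinite : Groupoid → Set
IsLocallyFinite 𝒢 = ∀ A B → Σ ℕ λ n → Hom A B ↔ Fin n
  where open Groupoid 𝒢

-- Skeletal: isomorphic objects are equal (in a groupoid every morphism is an iso).
IsSkeletal : Groupoid → Set
IsSkeletal 𝒢 = ∀ {A B} → Hom A B → A ≡ B
  where open Groupoid 𝒢

-- A 1-morphism 𝒢 → 𝟏 of GpdAct: a functor 𝟏ᵒᵖ × 𝒢 → Set, i.e. a covariant
-- functor 𝒢 → Set (object part and action on morphisms).
record OneMorTo𝟏 (𝒢 : Groupoid) : Set₁ where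
  open Groupoid 𝒢
  field
    F₀ : Obj → Set
    F₁ : ∀ {A B} → Hom A B → F₀ A → F₀ B

-- A 2-morphism σ : F ⇒ F' in GpdAct: a natural transformation F × F' ⇒ ℕ
-- (ℕ the constant functor), i.e. invariant ℕ-valued spans.
record TwoMor {𝒢 : Groupoid} (F F' : OneMorTo𝟏 𝒢) : Set where
  open Groupoid 𝒢
  open OneMorTo𝟏 F renaming (F₀ to X₀; F₁ to X₁)
  open OneMorTo𝟏 F' renaming (F₀ to Y₀; F₁ to Y₁)
  field
    σ : ∀ c → X₀ c → Y₀ c → ℕ
    natural : ∀ {c c'} (f : Hom c c') (x : X₀ c) (y : Y₀ c) →
              σ c' (X₁ f x) (Y₁ f y) ≡ σ c x y

-- 2-morphisms F ⇒ F' form a set; equality is equality of the component functions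
-- (pointwise, since we have no function extensionality).
TwoMorSetoid : {𝒢 : Groupoid} (F F' : OneMorTo𝟏 𝒢) → Setoid _ _
TwoMorSetoid {𝒢} F F' = record
  { Carrier = TwoMor F F'
  ; _≈_ = λ s t → ∀ c x y → TwoMor.σ s c x y ≡ TwoMor.σ t c x y
  ; isEquivalence = record
    { refl = λ c x y → Eq.refl
    ; sym = λ p c x y → Eq.sym (p c x y)
    ; trans = λ p q c x y → Eq.trans (p c x y) (q c x y) } }

-- Since 𝒢 is skeletal, a morphism f : A → B
-- has A ≡ B; the postcomposite f ∘ h : A → B is transported along this
-- equality to an element of Hom(B,B).
P : (𝒢 : Groupoid) → IsSkeletal 𝒢 → (S : Set) → OneMorTo𝟏 𝒢
P 𝒢 sk S = record
  { F₀ = λ G → Hom G G × S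
  ; F₁ = λ {A} {B} f → λ { (h , s) → subst (λ X → Hom X B) (sk f) (f ∘ h) , s } }
  where open Groupoid 𝒢

FamSetoid : (𝒢 : Groupoid) (S : Set) → Setoid _ _
FamSetoid 𝒢 S = record
  { Carrier = (G : Obj) → S → Hom G G × S → ℕ
  ; _≈_ = λ τ υ → ∀ G s hs → τ G s hs ≡ υ G s hs
  ; isEquivalence = record
    { refl = λ G s hs → Eq.refl
    ; sym = λ p G s hs → Eq.sym (p G s hs)
    ; trans = λ p q G s hs → Eq.trans (p G s hs) (q G s hs) } }
  where open Groupoid 𝒢

-- An endomorphism h of G acts on P(G) = Hom(G,G) × S by postcomposition, so the
-- "difference" inv h ∘ h' of two first coordinates is invariant, and every pair
-- ((h , s) , (h' , s')) is moved by inv h to ((id , s) , (inv h ∘ h' , s')).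
-- Hence an invariant span σ is determined by its restriction to pairs whose first
-- point has first coordinate id, and any family of spans extends invariantly by
-- reading it off the difference.
module Submission where

open import Data.Nat using (ℕ)
open import Data.Product using (_×_; _,_)
open import Function.Bundles using (Inverse)
open import Relation.Binary.PropositionalEquality

open import Defs

subst-K : ∀ {a b} {A : Set a} (B : A → Set b) {x : A} (p : x ≡ x) (u : B x) →
          subst B p u ≡ u
subst-K B refl u = refl

module GroupoidProperties (𝒢 : Groupoid) where
  open Groupoid 𝒢

  inv-id : ∀ {A} → inv (id {A}) ≡ id
  inv-id = trans (sym (idʳ (inv id))) (invˡ id)

  inv-id-∘ : ∀ {A B} (f : Hom A B) → inv id ∘ f ≡ f
  inv-id-∘ f = trans (cong (_∘ f) inv-id) (idˡ f)

  ∘-inv-cancelˡ : ∀ {A B C} (h : Hom B C) (g : Hom A C) → h ∘ (inv h ∘ g) ≡ g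
  ∘-inv-cancelˡ h g = trans (sym (assoc h (inv h) g)) (trans (cong (_∘ g) (invʳ h)) (idˡ g))

  inv-∘-cancelˡ : ∀ {A B C} (h : Hom B C) (g : Hom A B) → inv h ∘ (h ∘ g) ≡ g
  inv-∘-cancelˡ h g = trans (sym (assoc (inv h) h g)) (trans (cong (_∘ g) (invˡ h)) (idˡ g))

  inv-∘-∘ : ∀ {A B C D} (f : Hom B C) (h : Hom A B) (h' : Hom D B) →
            inv (f ∘ h) ∘ (f ∘ h') ≡ inv h ∘ h'
  inv-∘-∘ f h h' = begin
    inv (f ∘ h) ∘ (f ∘ h')                ≡⟨ cong (λ g → inv (f ∘ h) ∘ (f ∘ g)) (sym (∘-inv-cancelˡ h h')) ⟩
    inv (f ∘ h) ∘ (f ∘ (h ∘ (inv h ∘ h'))) ≡⟨ cong (inv (f ∘ h) ∘_) (sym (assoc f h _)) ⟩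
    inv (f ∘ h) ∘ ((f ∘ h) ∘ (inv h ∘ h')) ≡⟨ inv-∘-cancelˡ (f ∘ h) _ ⟩
    inv h ∘ h'                             ∎
    where open ≡-Reasoning

module Endomorphisms (𝒢 : Groupoid) (sk : IsSkeletal 𝒢) (S : Set) where
  open Groupoid 𝒢
  open GroupoidProperties 𝒢
  open OneMorTo𝟏 (P 𝒢 sk S)

  Family : Set
  Family = (G : Obj) → S → Hom G G × S → ℕ

  -- Skeletality only transports along a loop sk h : G ≡ G, which K discards.
  F₁-endo : ∀ {G} (h g : Hom G G) (s : S) → F₁ h (g , s) ≡ (h ∘ g , s)
  F₁-endo h g s = cong (_, s) (subst-K (λ X → Hom X _) (sk h) (h ∘ g))

  extend-natural : (τ : Family) (s s' : S) {c c' : Obj} (p : c ≡ c') (f : Hom c c') (h h' : Hom c c) →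
                   let fh  = subst (λ X → Hom X c') p (f ∘ h)
                       fh' = subst (λ X → Hom X c') p (f ∘ h')
                   in τ c' s (inv fh ∘ fh' , s') ≡ τ c s (inv h ∘ h' , s')
  extend-natural τ s s' refl f h h' = cong (λ g → τ _ s (g , s')) (inv-∘-∘ f h h')

  extend : Family → TwoMor (P 𝒢 sk S) (P 𝒢 sk S)
  extend τ = record
    { σ       = λ { G (h , s) (h' , s') → τ G s (inv h ∘ h' , s') }
    ; natural = λ { f (h , s) (h' , s') → extend-natural τ s s' (sk f) f h h' } }

  restrict : TwoMor (P 𝒢 sk S) (P 𝒢 sk S) → Family
  restrict t G s = TwoMor.σ t G (id , s)

  restrict-extend : ∀ τ G s h' s' → restrict (extend τ) G s (h' , s') ≡ τ G s (h' , s')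
  restrict-extend τ G s h' s' = cong (λ g → τ G s (g , s')) (inv-id-∘ h')

  extend-restrict : ∀ t G h s h' s' →
                    TwoMor.σ (extend (restrict t)) G (h , s) (h' , s') ≡ TwoMor.σ t G (h , s) (h' , s')
  extend-restrict t G h s h' s' = begin
    σ G (id , s) (inv h ∘ h' , s')                   ≡⟨ sym (natural h (id , s) (inv h ∘ h' , s')) ⟩
    σ G (F₁ h (id , s)) (F₁ h (inv h ∘ h' , s'))     ≡⟨ cong₂ (σ G) (F₁-endo h id s) (F₁-endo h _ s') ⟩
    σ G (h ∘ id , s) (h ∘ (inv h ∘ h') , s')         ≡⟨ cong₂ (λ g g' → σ G (g , s) (g' , s'))
                                                              (idʳ h) (∘-inv-cancelˡ h h') ⟩
    σ G (h , s) (h' , s')                            ∎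
    where
      open ≡-Reasoning
      open TwoMor t

lemma4 : (𝒢 : Groupoid) (sk : IsSkeletal 𝒢) (lf : IsLocallyFinite 𝒢) (S : Set) →
         Inverse (TwoMorSetoid (P 𝒢 sk S) (P 𝒢 sk S)) (FamSetoid 𝒢 S)
lemma4 𝒢 sk _ S = record
  { to        = restrict
  ; from      = extend
  ; to-cong   = λ t≈u G s → t≈u G (id , s)
  ; from-cong = λ { τ≈υ G (h , s) (h' , s') → τ≈υ G s (inv h ∘ h' , s') }
  ; inverse   = (λ { {τ} t≈τ G s (h' , s') → trans (t≈τ G (id , s) (h' , s')) (restrict-extend τ G s h' s') })
              , (λ { {t} τ≈t G (h , s) (h' , s') → trans (τ≈t G s (inv h ∘ h' , s')) (extend-restrict t G h s h' s') })
  }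
  where
    open Groupoid 𝒢
    open Endomorphisms 𝒢 sk S
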